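{- Let $\mathcal{G}$ be a temporal graph whose underlying graph is a tree. Suppose a root $r$ can be chosen such that, for every vertex $v$, the edges incident to $v$ are active strictly before all other edges in the subtree rooted at $v$. Then the $\geq$-connected-VIM width of $\mathcal{G}$ is $\max_t\max_v\deg_{G'_t}(v)+1$, where $G'_t$ is the snapshot at time $t$ of the temporal graph $\mathcal{G}'$ obtained from $\mathcal{G}$ by adding the time-edge $(uv,t)$ for all vertices $u,v$ and times $t$ for which there exist times $t_1<t<t_2$ with $(uv,t_1)$ and $(uv,t_2)$ time-edges of $\mathcal{G}$.
   Context: A temporal graph $\mathcal{G}=(G,\lambda)$: static (underlying) graph $G=(V,E)$ and $\lambda:E\to 2^{\mathbb{N}}$; time-edges $(e,t)$ with $t\in\lambda(e)$; snapshot $G_t=(V,\{e:t\in\lambda(e)\})$; lifetime $\Lambda=\max_e\max\lambda(e)$. VIM sequence: $F_t=\{v:\exists u,w,\ \min\lambda(vu)\le t\le\max\lambda(vw)\}$ for $t\in[\Lambda]$. $G_{\ge}(t)$ is the static graph on $V$ whose edges are those having a time-edge at time $\ge t$. The $\geq$-connected-VIM width is $\max\{|V(C)\cap F_t|: t\in[\Lambda],\ C \text{ a connected component of } G_{\ge}(t)\}$. -}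

module Defs where

open import Data.Nat using (ℕ; zero; suc; _≤_; _<_; _⊔_)
open import Data.Fin using (Fin)
open import Data.Fin.Subset as Sub using (Subset; ∣_∣)
open import Data.List using (List; []; _∷_; length; foldr; concatMap; allFin)
open import Data.List.Membership.Propositional using (_∈_)
open import Data.List.Relation.Unary.Unique.Propositional using (Unique)
open import Data.Product using (Σ; ∃; _×_)
open import Data.Sum using (_⊎_)
open import Relation.Binary.PropositionalEquality using (_≡_; _≢_)
open import Relation.Nullary using (¬_)

-- A temporal graph on vertex set Fin n.  lab u v is the (finite) set of
-- times λ(uv) at which the edge uv is active (given as a list; only
-- membership matters).
record TemporalGraph (n : ℕ) : Set where
  field
    lab    : Fin n → Fin n → List ℕ
    sym    : ∀ u v → lab u v ≡ lab v u
    noLoop : ∀ v → lab v v ≡ []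
    pos    : ∀ u v t → t ∈ lab u v → 1 ≤ t
open TemporalGraph public

module _ {n : ℕ} where

  data Path (E : Fin n → Fin n → Set) : Fin n → Fin n → List (Fin n) → Set where
    [_]  : ∀ v → Path E v v (v ∷ [])
    _∷_  : ∀ {u w v vs} → E u w → Path E w v vs → Path E u v (u ∷ vs)

  SimplePath : (Fin n → Fin n → Set) → Fin n → Fin n → List (Fin n) → Set
  SimplePath E u v vs = Path E u v vs × Unique vs

  Connected : (Fin n → Fin n → Set) → Set
  Connected E = ∀ u v → ∃ λ vs → Path E u v vs

  HasCycle : (Fin n → Fin n → Set) → Set
  HasCycle E = Σ (Fin n) λ u → Σ (Fin n) λ v → Σ (List (Fin n)) λ vs →
    SimplePath E u v vs × 3 ≤ length vs × E v u

  IsTree : (Fin n → Fin n → Set) → Set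
  IsTree E = Connected E × ¬ HasCycle E

  Card : (Fin n → Set) → ℕ → Set
  Card P k = Σ (Subset n) λ S →
    (∀ w → (w Sub.∈ S → P w) × (P w → w Sub.∈ S)) × ∣ S ∣ ≡ k

module _ {n : ℕ} (G : TemporalGraph n) where

  Edge : Fin n → Fin n → Set
  Edge u v = ∃ λ t → t ∈ lab G u v

  lifetime : ℕ
  lifetime = foldr _⊔_ 0
    (concatMap (λ u → concatMap (λ v → lab G u v) (allFin n)) (allFin n))

  InSubtree : Fin n → Fin n → Fin n → Set
  InSubtree r v w = ∃ λ vs → SimplePath Edge r w vs × v ∈ vs

  IncidentEdgesFirst : Fin n → Set
  IncidentEdgesFirst r = ∀ v c a b → Edge v c → Edge a b →
    InSubtree r v a → InSubtree r v b → a ≢ v → b ≢ v →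
    ∀ t₁ t₂ → t₁ ∈ lab G v c → t₂ ∈ lab G a b → t₁ < t₂

  -- VIM sequence: v ∈ F_t iff ∃ u w, min λ(vu) ≤ t ≤ max λ(vw)
  -- (min λ(vu) ≤ t  iff some label of vu is ≤ t; t ≤ max λ(vw) likewise)
  InF : ℕ → Fin n → Set
  InF t v = Σ (Fin n) λ u → Σ (Fin n) λ w →
    (∃ λ t₁ → t₁ ∈ lab G v u × t₁ ≤ t) × (∃ λ t₂ → t₂ ∈ lab G v w × t ≤ t₂)

  EdgeGe : ℕ → Fin n → Fin n → Set
  EdgeGe t u v = ∃ λ s → s ∈ lab G u v × t ≤ s

  ReachGe : ℕ → Fin n → Fin n → Set
  ReachGe t v w = ∃ λ vs → Path (EdgeGe t) v w vs

  CompVIM : ℕ → Fin n → ℕ → Set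
  CompVIM t v k = Card (λ w → ReachGe t v w × InF t w) k

  IsConnVIMWidth : ℕ → Set
  IsConnVIMWidth W =
    (Σ ℕ λ t → 1 ≤ t × t ≤ lifetime × Σ (Fin n) λ v → CompVIM t v W)
    × (∀ t → 1 ≤ t → t ≤ lifetime → ∀ v k → CompVIM t v k → k ≤ W)

  TimeEdge' : Fin n → Fin n → ℕ → Set
  TimeEdge' u v t = t ∈ lab G u v ⊎
    (Σ ℕ λ t₁ → Σ ℕ λ t₂ → t₁ ∈ lab G u v × t₂ ∈ lab G u v × t₁ < t × t < t₂)

  Deg' : ℕ → Fin n → ℕ → Set
  Deg' t v d = Card (λ u → TimeEdge' u v t) d

  IsMaxDeg' : ℕ → Set
  IsMaxDeg' D = (Σ ℕ λ t → Σ (Fin n) λ v → Deg' t v D)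
    × (∀ t v d → Deg' t v d → d ≤ D)

module Submission where

-- Let x be the vertex of a component C of G≥(t) closest to the root. A vertex w ≠ x of C ∩ F_t
-- has a label ≤ t on some edge w u. If u ≠ x, the edge w u lies in the subtree of x and avoids
-- x, so by hypothesis every label of the first edge from x into C is smaller than that label,
-- although this edge is active at some time ≥ t. So u = x; and as the only path from x to its
-- neighbour w is their edge, x w is also active at some time ≥ t. Hence (x w, t) is a time-edge
-- of G′: C ∩ F_t consists of x and its neighbours in G′_t, and has at most Δ + 1 elements. For
-- a vertex of maximum G′-degree Δ (at least 1, as a tree on two or more vertices has an edge),
-- its closed neighbourhood in G′_t lies in its component and in F_t, so the bound is attained.

open import Defs
open import Data.Empty using (⊥)
open import Data.Fin using (Fin; zero; suc)
open import Data.Fin.Properties using () renaming (_≟_ to _≟ᶠ_)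
open import Data.Fin.Subset as Subset using (Subset; inside; outside; ⁅_⁆; _∪_; ∣_∣)
open import Data.Fin.Subset.Properties
  using ( p⊆q⇒∣p∣≤∣q∣; ∣⊥∣≡0; ∣⁅x⁆∣≡1; ∉⊥; ∪-identityˡ; x∈p∪q⁻; x∈p∪q⁺; x∈⁅y⁆⇒x≡y; x∈⁅x⁆
        ; nonempty?; Empty-unique)
open import Data.List using (List; []; _∷_; _∷ʳ_; length; foldr; allFin; upTo; cartesianProduct)
open import Data.List.Extrema.Nat using (argmax; argmax-all; f[xs]≤f[argmax])
open import Data.List.Membership.Propositional using (_∈_; _∉_; find; lose)
import Data.List.Membership.DecPropositional as DecMembership
open import Data.List.Membership.Propositional.Properties
  using (∈-concatMap⁺; ∈-allFin; ∈-++⁻; ∈-upTo⁺; ∈-upTo⁻; ∈-cartesianProduct⁺; ∈-cartesianProduct⁻)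
import Data.List.Relation.Unary.All as All
open All using ([])
open import Data.List.Relation.Unary.All.Properties using (¬Any⇒All¬)
open import Data.List.Relation.Unary.AllPairs using ([]; _∷_)
open import Data.List.Relation.Unary.Any using (here; there; any?)
open import Data.List.Relation.Unary.Unique.Propositional using (Unique)
open import Data.Nat using (ℕ; zero; suc; _≤_; _⊔_; z≤n; s≤s; s≤s⁻¹)
open import Data.Nat.Properties using (≤-refl; ≤-trans; ≤-antisym; <⇒≤; ≤∧≢⇒<; ≤⇒≯; m≤m⊔n; m≤n⊔m; _≟_; _≤?_)
open import Data.Product using (∃; ∃₂; _×_; _,_; proj₁; proj₂; uncurry)
open import Data.Sum using (_⊎_; inj₁; inj₂)
open import Data.Vec using (_∷_; tabulate; here; there)
open import Data.Vec.Properties using (lookup∘tabulate; []=⇒lookup; lookup⇒[]=)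
open import Function using (_∘_; id)
open import Relation.Binary.PropositionalEquality as ≡ using (_≡_; _≢_; refl; cong; subst)
open import Relation.Nullary using (¬_; Dec; yes; no; does; contradiction)
open import Relation.Nullary.Decidable using (dec-true; map′; _×-dec_; _⊎-dec_)
open import Relation.Unary using (Decidable)

Reach : {n : ℕ} → (Fin n → Fin n → Set) → Fin n → Fin n → Set
Reach E u v = ∃ (Path E u v)

module _ {n : ℕ} {E : Fin n → Fin n → Set} where
  open DecMembership (_≟ᶠ_ {n}) using (_∈?_)

  Path-head∈ : ∀ {u v vs} → Path E u v vs → u ∈ vs
  Path-head∈ [ _ ]   = here refl
  Path-head∈ (_ ∷ _) = here refl

  Path-map : ∀ {E′ : Fin n → Fin n → Set} {u v vs} →
    (∀ {a b} → a ∈ vs → b ∈ vs → E a b → E′ a b) → Path E u v vs → Path E′ u v vs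
  Path-map f [ v ]   = [ v ]
  Path-map f (e ∷ p) =
    f (here refl) (there (Path-head∈ p)) e ∷ Path-map (λ a∈ b∈ → f (there a∈) (there b∈)) p

  Path-∷ʳ : ∀ {u w v vs} → Path E u w vs → E w v → Path E u v (vs ∷ʳ v)
  Path-∷ʳ [ _ ]    e = e ∷ [ _ ]
  Path-∷ʳ (e′ ∷ p) e = e′ ∷ Path-∷ʳ p e

  Path-length≥1 : ∀ {u v vs} → Path E u v vs → 1 ≤ length vs
  Path-length≥1 [ _ ]   = s≤s z≤n
  Path-length≥1 (_ ∷ _) = s≤s z≤n

  Path-firstEdge : ∀ {u v vs} → u ≢ v → Path E u v vs → ∃ (E u)
  Path-firstEdge u≢u [ _ ]   = contradiction refl u≢u
  Path-firstEdge _   (e ∷ _) = _ , e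

  reach-trans : ∀ {u w v} → Reach E u w → Reach E w v → Reach E u v
  reach-trans (_ , [ _ ]) q = q
  reach-trans (_ , e ∷ p) q = _ , e ∷ proj₂ (reach-trans (_ , p) q)

  reach-sym : (∀ {a b} → E a b → E b a) → ∀ {u v} → Reach E u v → Reach E v u
  reach-sym E-sym (_ , [ v ]) = _ , [ v ]
  reach-sym E-sym (_ , e ∷ p) = _ , Path-∷ʳ (proj₂ (reach-sym E-sym (_ , p))) (E-sym e)

  simplePath-from : ∀ {u w v ws} → Path E w v ws → Unique ws → u ∈ ws → ∃ (SimplePath E u v)
  simplePath-from p@([ _ ]) ws! (here refl) = _ , p , ws!
  simplePath-from p@(_ ∷ _) ws! (here refl) = _ , p , ws!
  simplePath-from (_ ∷ p) (_ ∷ ws!) (there u∈) = simplePath-from p ws! u∈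

  Path-simplify : ∀ {u v vs} → Path E u v vs → ∃ (SimplePath E u v)
  Path-simplify [ v ] = _ , [ v ] , [] ∷ []
  Path-simplify {u} (e ∷ p) with Path-simplify p
  ... | ws , q , ws! with u ∈? ws
  ...   | yes u∈ws = simplePath-from q ws! u∈ws
  ...   | no  u∉ws = _ , e ∷ q , ¬Any⇒All¬ ws u∉ws ∷ ws!

module _ {n : ℕ} {P Q : Fin n → Set} where

  Card-⊆ : ∀ {k l} → Card P k → Card Q l → (∀ {w} → P w → Q w) → k ≤ l
  Card-⊆ (S , S↔P , refl) (T , T↔Q , refl) P⊆Q =
    p⊆q⇒∣p∣≤∣q∣ (λ {w} w∈S → proj₂ (T↔Q w) (P⊆Q (proj₁ (S↔P w) w∈S)))

  Card-cong : ∀ {k} → (∀ {w} → P w → Q w) → (∀ {w} → Q w → P w) → Card P k → Card Q k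
  Card-cong P⊆Q Q⊆P (S , S↔P , ∣S∣≡k) =
    S , (λ w → (λ w∈S → P⊆Q (proj₁ (S↔P w) w∈S)) , (λ qw → proj₂ (S↔P w) (Q⊆P qw))) , ∣S∣≡k

∣⁅x⁆∪p∣≡1+∣p∣ : ∀ {n} {x : Fin n} {p : Subset n} → x Subset.∉ p → ∣ ⁅ x ⁆ ∪ p ∣ ≡ suc ∣ p ∣
∣⁅x⁆∪p∣≡1+∣p∣ {x = zero}  {outside ∷ p} _   = cong (suc ∘ ∣_∣) (∪-identityˡ p)
∣⁅x⁆∪p∣≡1+∣p∣ {x = zero}  {inside  ∷ p} x∉p = contradiction here x∉p
∣⁅x⁆∪p∣≡1+∣p∣ {x = suc x} {outside ∷ p} x∉p = ∣⁅x⁆∪p∣≡1+∣p∣ (x∉p ∘ there)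
∣⁅x⁆∪p∣≡1+∣p∣ {x = suc x} {inside  ∷ p} x∉p = cong suc (∣⁅x⁆∪p∣≡1+∣p∣ (x∉p ∘ there))

module _ {n : ℕ} where

  subsetOf : {P : Fin n → Set} → Decidable P → Subset n
  subsetOf P? = tabulate (λ w → does (P? w))

  Card-subsetOf : {P : Fin n → Set} (P? : Decidable P) → Card P ∣ subsetOf P? ∣
  Card-subsetOf {P} P? = subsetOf P? , (λ w → to w , from w) , refl
    where
    to : ∀ w → w Subset.∈ subsetOf P? → P w
    to w w∈ with P? w | ≡.trans (≡.sym (lookup∘tabulate (λ w → does (P? w)) w)) ([]=⇒lookup w∈)
    ... | yes pw | _  = pw
    ... | no  _  | ()
    from : ∀ w → P w → w Subset.∈ subsetOf P?
    from w pw = lookup⇒[]= w _ (≡.trans (lookup∘tabulate _ w) (dec-true (P? w) pw))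

  Card-insert : ∀ {P : Fin n → Set} {k a} → Card P k → ¬ P a → Card (λ w → w ≡ a ⊎ P w) (suc k)
  Card-insert {a = a} (S , S↔P , refl) ¬pa =
    ⁅ a ⁆ ∪ S , (λ w → to w , from w) , ∣⁅x⁆∪p∣≡1+∣p∣ (¬pa ∘ proj₁ (S↔P a))
    where
    to : ∀ w → w Subset.∈ ⁅ a ⁆ ∪ S → _
    to w w∈ with x∈p∪q⁻ ⁅ a ⁆ S w∈
    ... | inj₁ w∈⁅a⁆ = inj₁ (x∈⁅y⁆⇒x≡y a w∈⁅a⁆)
    ... | inj₂ w∈S   = inj₂ (proj₁ (S↔P w) w∈S)
    from : ∀ w → _ → w Subset.∈ ⁅ a ⁆ ∪ S
    from w (inj₁ refl) = x∈p∪q⁺ (inj₁ (x∈⁅x⁆ w))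
    from w (inj₂ pw)   = x∈p∪q⁺ (inj₂ (proj₂ (S↔P w) pw))

  Card-singleton : ∀ {a : Fin n} → Card (_≡ a) 1
  Card-singleton {a} = ⁅ a ⁆ , (λ w → x∈⁅y⁆⇒x≡y a , λ { refl → x∈⁅x⁆ w }) , ∣⁅x⁆∣≡1 a

  Card-empty : ∀ {P : Fin n → Set} → (∀ w → ¬ P w) → Card P 0
  Card-empty ¬P =
    Subset.⊥ , (λ w → (λ w∈⊥ → contradiction w∈⊥ ∉⊥) , λ pw → contradiction pw (¬P w)) , ∣⊥∣≡0 n

  Card-witness : ∀ {P : Fin n → Set} {k} → Card P k → 1 ≤ k → ∃ P
  Card-witness (S , S↔P , refl) 1≤∣S∣ with nonempty? S
  ... | yes (w , w∈S) = w , proj₁ (S↔P w) w∈S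
  ... | no  S-empty   =
    contradiction (subst (1 ≤_) (≡.trans (cong ∣_∣ (Empty-unique S-empty)) (∣⊥∣≡0 n)) 1≤∣S∣) λ ()

∈⇒≤foldr⊔ : ∀ {s ts} → s ∈ ts → s ≤ foldr _⊔_ 0 ts
∈⇒≤foldr⊔ {ts = t ∷ ts} (here refl) = m≤m⊔n t _
∈⇒≤foldr⊔ {ts = t ∷ ts} (there s∈) = ≤-trans (∈⇒≤foldr⊔ s∈) (m≤n⊔m t _)

anyLabel? : {P : ℕ → Set} → Decidable P → (ts : List ℕ) → Dec (∃ λ s → s ∈ ts × P s)
anyLabel? P? ts = map′ find (λ (_ , s∈ts , ps) → lose s∈ts ps) (any? P? ts)

module _ {n : ℕ} (G : TemporalGraph n) where

  EdgeLe : ℕ → Fin n → Fin n → Set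
  EdgeLe t u v = ∃ λ s → s ∈ lab G u v × s ≤ t

  lab-sym : ∀ {s u v} → s ∈ lab G u v → s ∈ lab G v u
  lab-sym {s} {u} {v} = subst (s ∈_) (TemporalGraph.sym G u v)

  Edge-sym : ∀ {u v} → Edge G u v → Edge G v u
  Edge-sym (s , s∈) = s , lab-sym s∈

  EdgeGe-sym : ∀ {t u v} → EdgeGe G t u v → EdgeGe G t v u
  EdgeGe-sym (s , s∈ , t≤s) = s , lab-sym s∈ , t≤s

  EdgeLe-sym : ∀ {t u v} → EdgeLe t u v → EdgeLe t v u
  EdgeLe-sym (s , s∈ , s≤t) = s , lab-sym s∈ , s≤t

  EdgeGe⇒Edge : ∀ {t u v} → EdgeGe G t u v → Edge G u v
  EdgeGe⇒Edge (s , s∈ , _) = s , s∈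

  EdgeLe⇒Edge : ∀ {t u v} → EdgeLe t u v → Edge G u v
  EdgeLe⇒Edge (s , s∈ , _) = s , s∈

  Edge-irrefl : ∀ {u v} → Edge G u v → u ≢ v
  Edge-irrefl {u} (s , s∈) refl with subst (s ∈_) (noLoop G u) s∈
  ... | ()

  label≤lifetime : ∀ {s u v} → s ∈ lab G u v → s ≤ lifetime G
  label≤lifetime {u = u} {v} s∈ =
    ∈⇒≤foldr⊔ (∈-concatMap⁺ _ (lose (∈-allFin u) (∈-concatMap⁺ _ (lose (∈-allFin v) s∈))))

  EdgeGe? : ∀ t u v → Dec (EdgeGe G t u v)
  EdgeGe? t u v = anyLabel? (t ≤?_) (lab G u v)

  EdgeLe? : ∀ t u v → Dec (EdgeLe t u v)
  EdgeLe? t u v = anyLabel? (_≤? t) (lab G u v)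

  TimeEdge'⇒EdgeLe×EdgeGe : ∀ {t u v} → TimeEdge' G u v t → EdgeLe t u v × EdgeGe G t u v
  TimeEdge'⇒EdgeLe×EdgeGe {t} (inj₁ t∈) = (t , t∈ , ≤-refl) , (t , t∈ , ≤-refl)
  TimeEdge'⇒EdgeLe×EdgeGe (inj₂ (t₁ , t₂ , t₁∈ , t₂∈ , t₁<t , t<t₂)) =
    (t₁ , t₁∈ , <⇒≤ t₁<t) , (t₂ , t₂∈ , <⇒≤ t<t₂)

  EdgeLe×EdgeGe⇒TimeEdge' : ∀ {t u v} → EdgeLe t u v × EdgeGe G t u v → TimeEdge' G u v t
  EdgeLe×EdgeGe⇒TimeEdge' {t} ((t₁ , t₁∈ , t₁≤t) , (t₂ , t₂∈ , t≤t₂)) with t₁ ≟ t | t ≟ t₂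
  ... | yes refl | _        = inj₁ t₁∈
  ... | no _     | yes refl = inj₁ t₂∈
  ... | no t₁≢t  | no t≢t₂  = inj₂ (t₁ , t₂ , t₁∈ , t₂∈ , ≤∧≢⇒< t₁≤t t₁≢t , ≤∧≢⇒< t≤t₂ t≢t₂)

  TimeEdge'? : ∀ t u v → Dec (TimeEdge' G u v t)
  TimeEdge'? t u v =
    map′ EdgeLe×EdgeGe⇒TimeEdge' TimeEdge'⇒EdgeLe×EdgeGe (EdgeLe? t u v ×-dec EdgeGe? t u v)

  TimeEdge'⇒InFˡ : ∀ {t u v} → TimeEdge' G u v t → InF G t u
  TimeEdge'⇒InFˡ te = let le , ge = TimeEdge'⇒EdgeLe×EdgeGe te in _ , _ , le , ge

  TimeEdge'⇒InFʳ : ∀ {t u v} → TimeEdge' G u v t → InF G t v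
  TimeEdge'⇒InFʳ te = let le , ge = TimeEdge'⇒EdgeLe×EdgeGe te in _ , _ , EdgeLe-sym le , EdgeGe-sym ge

  TimeEdge'-irrefl : ∀ {t x} → ¬ TimeEdge' G x x t
  TimeEdge'-irrefl te = Edge-irrefl (EdgeLe⇒Edge (proj₁ (TimeEdge'⇒EdgeLe×EdgeGe te))) refl

  TimeEdge'⇒1≤t : ∀ {t u v} → TimeEdge' G u v t → 1 ≤ t
  TimeEdge'⇒1≤t te with proj₁ (TimeEdge'⇒EdgeLe×EdgeGe te)
  ... | s , s∈ , s≤t = ≤-trans (pos G _ _ s s∈) s≤t

  TimeEdge'⇒t≤lifetime : ∀ {t u v} → TimeEdge' G u v t → t ≤ lifetime G
  TimeEdge'⇒t≤lifetime te with proj₂ (TimeEdge'⇒EdgeLe×EdgeGe te)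
  ... | s , s∈ , t≤s = ≤-trans t≤s (label≤lifetime s∈)

  deg' : ℕ → Fin n → ℕ
  deg' t x = ∣ subsetOf (λ w → TimeEdge'? t w x) ∣

  Deg'-deg' : ∀ t x → Deg' G t x (deg' t x)
  Deg'-deg' t x = Card-subsetOf (λ w → TimeEdge'? t w x)

  label⇒1≤deg' : ∀ {s u v} → s ∈ lab G u v → 1 ≤ deg' s v
  label⇒1≤deg' s∈ = Card-⊆ Card-singleton (Deg'-deg' _ _) (λ { refl → inj₁ s∈ })

  deg'-beyondLifetime : ∀ {t} x → ¬ t ≤ lifetime G → deg' t x ≤ 0
  deg'-beyondLifetime x t≰Λ =
    Card-⊆ (Deg'-deg' _ x) (Card-empty λ _ te → t≰Λ (TimeEdge'⇒t≤lifetime te)) id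

  closedNeighbourhood⊆componentVIM : ∀ {t x w} → InF G t x → w ≡ x ⊎ TimeEdge' G w x t →
    ReachGe G t x w × InF G t w
  closedNeighbourhood⊆componentVIM x∈F (inj₁ refl) = (_ , [ _ ]) , x∈F
  closedNeighbourhood⊆componentVIM x∈F (inj₂ te) =
    (_ , EdgeGe-sym (proj₂ (TimeEdge'⇒EdgeLe×EdgeGe te)) ∷ [ _ ]) , TimeEdge'⇒InFˡ te

  closedNeighbourhood≤componentVIM : ∀ t x {k} → InF G t x → CompVIM G t x k → suc (deg' t x) ≤ k
  closedNeighbourhood≤componentVIM t x x∈F vim =
    Card-⊆ (Card-insert (Deg'-deg' t x) TimeEdge'-irrefl) vim (closedNeighbourhood⊆componentVIM x∈F)

  module PeakDegree (v₀ : Fin n) where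

    -- Opaque, since unfolding the argmax over all time–vertex pairs makes type checking intractable.
    opaque
      pairs : List (ℕ × Fin n)
      pairs = cartesianProduct (upTo (suc (lifetime G))) (allFin n)

      peak : ℕ × Fin n
      peak = argmax (uncurry deg') (0 , v₀) pairs

      peak≤lifetime : proj₁ peak ≤ lifetime G
      peak≤lifetime = argmax-all (uncurry deg') {P = λ p → proj₁ p ≤ lifetime G} {xs = pairs} z≤n
        (All.tabulate λ p∈ → s≤s⁻¹ (∈-upTo⁻ (proj₁ (∈-cartesianProduct⁻ _ _ p∈))))

      peak-maximal : ∀ t x → t ≤ lifetime G → deg' t x ≤ uncurry deg' peak
      peak-maximal t x t≤Λ = All.lookup (f[xs]≤f[argmax] (0 , v₀) pairs)
        (∈-cartesianProduct⁺ (∈-upTo⁺ (s≤s t≤Λ)) (∈-allFin x))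

    t* : ℕ
    t* = proj₁ peak

    x* : Fin n
    x* = proj₂ peak

    Δ : ℕ
    Δ = deg' t* x*

    deg'≤Δ : ∀ t x → deg' t x ≤ Δ
    deg'≤Δ t x with t ≤? lifetime G
    ... | yes t≤Λ = peak-maximal t x t≤Λ
    ... | no  t≰Λ = ≤-trans (deg'-beyondLifetime x t≰Λ) z≤n

    Deg'≤Δ : ∀ t x d → Deg' G t x d → d ≤ Δ
    Deg'≤Δ t x d deg = ≤-trans (Card-⊆ deg (Deg'-deg' t x) id) (deg'≤Δ t x)

  -- y x is the last edge of the path not active at any time ≥ t, and pre the part before it.
  LastGap : ℕ → Fin n → Fin n → List (Fin n) → Set
  LastGap t u v vs = ∃₂ λ y x → ∃ λ pre → Path (Edge G) u y pre × x ∉ pre × x ∈ vs ×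
    Edge G y x × ¬ EdgeGe G t y x × ReachGe G t x v

  lastGap : ∀ t {u v vs} → Path (Edge G) u v vs → Unique vs → Path (EdgeGe G t) u v vs ⊎ LastGap t u v vs
  lastGap t [ v ] _ = inj₁ [ v ]
  lastGap t {u} (_∷_ {w = w} uw p) (u∉ws ∷ ws!) with lastGap t p ws!
  ... | inj₂ (y , x , pre , u⇝y , x∉pre , x∈ws , yx , yx≱t , x⇝v) =
    inj₂ (y , x , u ∷ pre , uw ∷ u⇝y , x∉u∷pre , there x∈ws , yx , yx≱t , x⇝v)
    where
    x∉u∷pre : x ∉ u ∷ pre
    x∉u∷pre (here x≡u)   = All.lookup u∉ws x∈ws (≡.sym x≡u)
    x∉u∷pre (there x∈pre) = x∉pre x∈pre
  ... | inj₁ p≥t with EdgeGe? t u w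
  ...   | yes uw≥t = inj₁ (uw≥t ∷ p≥t)
  ...   | no  uw≱t = inj₂ (u , w , u ∷ [] , [ u ] , w∉[u] , there (Path-head∈ p) , uw , uw≱t , _ , p≥t)
    where
    w∉[u] : w ∉ u ∷ []
    w∉[u] (here w≡u) = All.lookup u∉ws (Path-head∈ p) (≡.sym w≡u)

module _ {n : ℕ} (G : TemporalGraph n) (tree : IsTree (Edge G)) where
  open DecMembership (_≟ᶠ_ {n}) using (_∈?_)

  EdgeAvoiding : Fin n → Fin n → Fin n → Fin n → Set
  EdgeAvoiding a b p q = Edge G p q × ¬ (p ≡ a × q ≡ b ⊎ p ≡ b × q ≡ a)

  EdgeAvoiding-sym : ∀ {a b p q} → EdgeAvoiding a b p q → EdgeAvoiding a b q p
  EdgeAvoiding-sym (pq , pq≢ab) =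
    Edge-sym G pq , λ { (inj₁ (q≡a , p≡b)) → pq≢ab (inj₂ (p≡b , q≡a))
                      ; (inj₂ (q≡b , p≡a)) → pq≢ab (inj₁ (p≡a , q≡b)) }

  edge-isBridge : ∀ {a b} → Edge G a b → ¬ Reach (EdgeAvoiding a b) a b
  edge-isBridge {a} {b} ab (_ , p) with Path-simplify p
  ... | _ , q , q! = noCycle q q! refl refl
    where
    noCycle : ∀ {x y zs} → Path (EdgeAvoiding a b) x y zs → Unique zs → x ≡ a → y ≡ b → ⊥
    noCycle [ _ ]            _  refl refl = Edge-irrefl G ab refl
    noCycle (e ∷ [ _ ])      _  refl refl = proj₂ e (inj₁ (refl , refl))
    noCycle q@(_ ∷ _ ∷ rest) q! refl refl = proj₂ tree
      (a , b , _ , (Path-map (λ _ _ → proj₁) q , q!) , s≤s (s≤s (Path-length≥1 rest)) , Edge-sym G ab)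

  path-uses-or-avoids : ∀ {t} a b {p q zs} → Path (EdgeGe G t) p q zs →
    EdgeGe G t a b ⊎ Path (EdgeAvoiding a b) p q zs
  path-uses-or-avoids a b [ _ ] = inj₂ [ _ ]
  path-uses-or-avoids a b (_∷_ {u = p} {w = p′} pp′ rest) with path-uses-or-avoids a b rest
  ... | inj₁ ab = inj₁ ab
  ... | inj₂ rest′ with (p ≟ᶠ a ×-dec p′ ≟ᶠ b) ⊎-dec (p ≟ᶠ b ×-dec p′ ≟ᶠ a)
  ...   | yes (inj₁ (refl , refl)) = inj₁ pp′
  ...   | yes (inj₂ (refl , refl)) = inj₁ (EdgeGe-sym G pp′)
  ...   | no  pp′≢ab               = inj₂ ((EdgeGe⇒Edge G pp′ , pp′≢ab) ∷ rest′)

  -- In a tree the only path between adjacent vertices is their edge.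
  reachGe-adjacent⇒EdgeGe : ∀ {t a b} → Edge G a b → ReachGe G t a b → EdgeGe G t a b
  reachGe-adjacent⇒EdgeGe {a = a} {b} ab (_ , p) with path-uses-or-avoids a b p
  ... | inj₁ ab≥t = ab≥t
  ... | inj₂ p′   = contradiction (_ , p′) (edge-isBridge ab)

  avoidsEdgesAt : ∀ {x y zs a b} → x ∉ zs → a ∈ zs → b ∈ zs → Edge G a b → EdgeAvoiding y x a b
  avoidsEdgesAt {zs = zs} x∉zs a∈ b∈ ab =
    ab , λ { (inj₁ (_ , refl)) → x∉zs b∈ ; (inj₂ (refl , _)) → x∉zs a∈ }

  EdgeGe-avoids : ∀ {t y x a b} → ¬ EdgeGe G t y x → EdgeGe G t a b → EdgeAvoiding y x a b
  EdgeGe-avoids yx≱t ab≥t = EdgeGe⇒Edge G ab≥t , λ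
    { (inj₁ (refl , refl)) → yx≱t ab≥t
    ; (inj₂ (refl , refl)) → yx≱t (EdgeGe-sym G ab≥t) }

  module _ (r : Fin n) where

    ComponentTop : ℕ → Fin n → Set
    ComponentTop t x = ∀ {w vs} → ReachGe G t x w → Path (Edge G) r w vs → x ∈ vs

    -- x is the endpoint of the last inactive edge on the root path of v, or the root itself.
    componentTop : ∀ t v → ∃ λ x → ReachGe G t v x × ComponentTop t x
    componentTop t v with Path-simplify (proj₂ (proj₁ tree r v))
    ... | _ , p , p! with lastGap G t p p!
    ...   | inj₁ p≥t = r , reach-sym (EdgeGe-sym G) (_ , p≥t) , λ _ → Path-head∈
    ...   | inj₂ (y , x , _ , r⇝y , x∉pre , _ , yx , yx≱t , x⇝v) = x , reach-sym (EdgeGe-sym G) x⇝v , x-top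
      where
      x-top : ComponentTop t x
      x-top {w} {vs} (_ , x⇝w) r⇝w with x ∈? vs
      ... | yes x∈vs = x∈vs
      ... | no  x∉vs = contradiction (reach-trans y⇝r (reach-trans (_ , r⇝w′) w⇝x)) (edge-isBridge yx)
        where
        y⇝r : Reach (EdgeAvoiding y x) y r
        y⇝r = reach-sym EdgeAvoiding-sym (_ , Path-map (avoidsEdgesAt x∉pre) r⇝y)
        r⇝w′ : Path (EdgeAvoiding y x) r w vs
        r⇝w′ = Path-map (avoidsEdgesAt x∉vs) r⇝w
        w⇝x : Reach (EdgeAvoiding y x) w x
        w⇝x = reach-sym EdgeAvoiding-sym (_ , Path-map (λ _ _ → EdgeGe-avoids yx≱t) x⇝w)

    module _ (ief : IncidentEdgesFirst G r) {t x} (x-top : ComponentTop t x) where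

      InSubtree-top : ∀ {w} → ReachGe G t x w → InSubtree G r x w
      InSubtree-top {w} x⇝w with Path-simplify (proj₂ (proj₁ tree r w))
      ... | vs , p , vs! = vs , (p , vs!) , x-top x⇝w p

      InSubtree-top-neighbour : ∀ {w u} → ReachGe G t x w → w ≢ x → Edge G w u → InSubtree G r x u
      InSubtree-top-neighbour {w} {u} x⇝w w≢x wu with Path-simplify (proj₂ (proj₁ tree r u))
      ... | vs , p , vs! with ∈-++⁻ vs (x-top x⇝w (Path-∷ʳ p (Edge-sym G wu)))
      ...   | inj₁ x∈vs       = vs , (p , vs!) , x∈vs
      ...   | inj₂ (here x≡w) = contradiction (≡.sym x≡w) w≢x

      EdgeLe-below-top : ∀ {w u} → ReachGe G t x w → w ≢ x → EdgeLe G t w u → u ≡ x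
      EdgeLe-below-top {w} {u} x⇝w w≢x (t₁ , t₁∈ , t₁≤t) with u ≟ᶠ x
      ... | yes u≡x = u≡x
      ... | no  u≢x with Path-firstEdge (w≢x ∘ ≡.sym) (proj₂ x⇝w)
      ...   | c , (s , s∈ , t≤s) = contradiction s<t₁ (≤⇒≯ (≤-trans t₁≤t t≤s))
        where
        s<t₁ = ief x c w u (s , s∈) (t₁ , t₁∈) (InSubtree-top x⇝w)
          (InSubtree-top-neighbour x⇝w w≢x (t₁ , t₁∈)) w≢x u≢x s t₁ s∈ t₁∈

      componentVIM⊆closedNeighbourhood : ∀ {w} → ReachGe G t x w → InF G t w → w ≡ x ⊎ TimeEdge' G w x t
      componentVIM⊆closedNeighbourhood {w} x⇝w (_ , _ , wu≤t , _) with w ≟ᶠ x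
      ... | yes w≡x = inj₁ w≡x
      ... | no  w≢x = inj₂ (EdgeLe×EdgeGe⇒TimeEdge' G (wx≤t , wx≥t))
        where
        wx≤t : EdgeLe G t w x
        wx≤t = subst (EdgeLe G t w) (EdgeLe-below-top x⇝w w≢x wu≤t) wu≤t
        wx≥t : EdgeGe G t w x
        wx≥t = EdgeGe-sym G (reachGe-adjacent⇒EdgeGe (Edge-sym G (EdgeLe⇒Edge G wx≤t)) x⇝w)

    module _ (ief : IncidentEdgesFirst G r) where

      componentVIM-count : ∀ t v → InF G t v → ∃ (CompVIM G t v)
      componentVIM-count t v v∈F with componentTop t v
      ... | x , v⇝x , x-top =
        suc (deg' G t x) ,
        Card-cong toComponent toNeighbourhood (Card-insert (Deg'-deg' G t x) (TimeEdge'-irrefl G))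
        where
        x⇝v : ReachGe G t x v
        x⇝v = reach-sym (EdgeGe-sym G) v⇝x
        toNeighbourhood : ∀ {w} → ReachGe G t v w × InF G t w → w ≡ x ⊎ TimeEdge' G w x t
        toNeighbourhood (v⇝w , w∈F) = componentVIM⊆closedNeighbourhood ief x-top (reach-trans x⇝v v⇝w) w∈F
        x∈F : InF G t x
        x∈F with toNeighbourhood ((_ , [ v ]) , v∈F)
        ... | inj₁ refl = v∈F
        ... | inj₂ vx   = TimeEdge'⇒InFʳ G vx
        toComponent : ∀ {w} → w ≡ x ⊎ TimeEdge' G w x t → ReachGe G t v w × InF G t w
        toComponent xw with closedNeighbourhood⊆componentVIM G x∈F xw
        ... | x⇝w , w∈F = reach-trans v⇝x x⇝w , w∈F

      module _ {Δ} (deg'≤Δ : ∀ t x → deg' G t x ≤ Δ) where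

        componentVIM≤1+Δ : ∀ t v k → CompVIM G t v k → k ≤ suc Δ
        componentVIM≤1+Δ t v _ vim with componentTop t v
        ... | x , v⇝x , x-top =
          ≤-trans (Card-⊆ vim (Card-insert (Deg'-deg' G t x) (TimeEdge'-irrefl G)) inclusion)
                  (s≤s (deg'≤Δ t x))
          where
          inclusion : ∀ {w} → ReachGe G t v w × InF G t w → w ≡ x ⊎ TimeEdge' G w x t
          inclusion (v⇝w , w∈F) =
            componentVIM⊆closedNeighbourhood ief x-top (reach-trans (reach-sym (EdgeGe-sym G) v⇝x) v⇝w) w∈F

        componentVIM-atMaxDegree : ∀ t x → InF G t x → Δ ≤ deg' G t x → CompVIM G t x (suc Δ)
        componentVIM-atMaxDegree t x x∈F Δ≤deg' = subst (CompVIM G t x) k≡1+Δ vim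
          where
          k : ℕ
          k = proj₁ (componentVIM-count t x x∈F)
          vim : CompVIM G t x k
          vim = proj₂ (componentVIM-count t x x∈F)
          k≡1+Δ : k ≡ suc Δ
          k≡1+Δ = ≤-antisym (componentVIM≤1+Δ t x k vim)
                            (≤-trans (s≤s Δ≤deg') (closedNeighbourhood≤componentVIM G t x x∈F vim))

mainTheorem14 : (n : ℕ) → 2 ≤ n → (G : TemporalGraph n) →
    IsTree (Edge G) → (r : Fin n) → IncidentEdgesFirst G r →
    ∃ λ D → IsMaxDeg' G D × IsConnVIMWidth G (suc D)
mainTheorem14 (suc zero) (s≤s ()) _ _ _ _
mainTheorem14 (suc (suc _)) _ G tree r ief =
  Δ , ((t* , x* , Deg'-deg' G t* x*) , Deg'≤Δ) ,
  (t* , TimeEdge'⇒1≤t G (proj₂ x*-neighbour) , peak≤lifetime , x* ,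
    componentVIM-atMaxDegree G tree r ief deg'≤Δ t* x* (TimeEdge'⇒InFʳ G (proj₂ x*-neighbour)) ≤-refl) ,
  (λ t _ _ → componentVIM≤1+Δ G tree r ief deg'≤Δ t)
  where
  open PeakDegree G r

  1≤Δ : 1 ≤ Δ
  1≤Δ with Path-firstEdge (λ ()) (proj₂ (proj₁ tree zero (suc zero)))
  ... | _ , (s , s∈) = ≤-trans (label⇒1≤deg' G s∈) (deg'≤Δ s _)

  x*-neighbour : ∃ λ u → TimeEdge' G u x* t*
  x*-neighbour = Card-witness (Deg'-deg' G t* x*) 1≤Δ
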